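{- Let $\mathbf{w}$ be the fixed point starting with $0$ of the morphism $0\mapsto03$, $1\mapsto43$, $3\mapsto1$, $4\mapsto01$ over the alphabet $\{0,1,3,4\}$. Then the additive complexity $\rho^{\mathrm{add}}_{\mathbf{w}}$ is unbounded.
   Context: Letters $0,1,3,4$ are regarded as integers. Words $u,v$ are additively equivalent if $|u|=|v|$ and $\sum_a a|u|_a=\sum_a a|v|_a$ ($|w|_a$ counts occurrences of $a$); $\rho^{\mathrm{add}}_{\mathbf{w}}(n)$ is the number of additive equivalence classes of length-$n$ factors of $\mathbf{w}$. -}

module Defs where

open import Data.Nat using (ℕ; zero; suc; _+_; _*_)
open import Data.List using (List; []; _∷_; concatMap; length; map; filter)
open import Data.Fin using (Fin)
open import Data.Product using (_×_)
open import Relation.Binary.PropositionalEquality using (_≡_)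
open import Relation.Nullary using (¬_)

data Letter : Set where
  a0 a1 a3 a4 : Letter

val : Letter → ℕ
val a0 = 0
val a1 = 1
val a3 = 3
val a4 = 4

Word : Set
Word = List Letter

σ : Letter → Word
σ a0 = a0 ∷ a3 ∷ []
σ a1 = a4 ∷ a3 ∷ []
σ a3 = a1 ∷ []
σ a4 = a0 ∷ a1 ∷ []

σ* : Word → Word
σ* = concatMap σ

iter : ℕ → Word
iter zero = a0 ∷ []
iter (suc n) = σ* (iter n)

-- i-th letter of a word (default a0 when out of range; never used, see below)
nth : Word → ℕ → Letter
nth [] _ = a0
nth (x ∷ xs) zero = x
nth (x ∷ xs) (suc i) = nth xs i

-- Since σ(0) starts with 0, σ^n(0) is a prefix of σ^(n+1)(0), and
-- |σ^n(0)| ≥ n+1, so index i is always in range of σ^(i+1)(0).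
w : ℕ → Letter
w i = nth (iter (suc i)) i

factor : ℕ → ℕ → Word
factor i zero = []
factor i (suc n) = w i ∷ factor (suc i) n

count : Letter → Word → ℕ
count a [] = 0
count a (x ∷ xs) with a | x
... | a0 | a0 = suc (count a xs)
... | a1 | a1 = suc (count a xs)
... | a3 | a3 = suc (count a xs)
... | a4 | a4 = suc (count a xs)
... | _  | _  = count a xs

weight : Word → ℕ
weight u = val a0 * count a0 u + val a1 * count a1 u + val a3 * count a3 u + val a4 * count a4 u

AddEquiv : Word → Word → Set
AddEquiv u v = (length u ≡ length v) × (weight u ≡ weight v)

AddComplexityAtLeast : ℕ → ℕ → Set
AddComplexityAtLeast n K =
  Data.Product.Σ (Fin K → ℕ) λ pos →
    ∀ (p q : Fin K) → ¬ (p ≡ q) → ¬ AddEquiv (factor (pos p) n) (factor (pos q) n)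

AddComplexityUnbounded : Set
AddComplexityUnbounded = ∀ (K : ℕ) → Data.Product.∃ λ (n : ℕ) → AddComplexityAtLeast n K

-- Sliding a window along w changes its weight by at most 4, so the weights of the
-- length-n factors fill an interval up to gaps of size 4; it therefore suffices to
-- find, for every C, two factors of a common length whose weights differ by more
-- than C.  If there are none at lengths n and m, tiling the prefix of length n m by
-- blocks of length n and by blocks of length m shows that any factors u, v of these
-- lengths satisfy n · weight v - m · weight u ≤ (n + m) C.  We take u = σᵏ(a) and
-- v = σᵏ(b): their lengths are at most 2ᵏ, whereas the 2 × 2 minors of the vectors
-- (|σᵏ(a)|)ₐ and (weight σᵏ(a))ₐ have a fixed sign pattern (alternating with k) and
-- a positive combination of them grows by a factor 9/4 with each application of σ.
module Submission where

open import Defs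
open import Data.Empty using (⊥-elim)
open import Data.Fin using (Fin; toℕ)
open import Data.Fin.Properties using (toℕ-injective; toℕ<n)
open import Data.Integer as ℤ using (ℤ; +_)
import Data.Integer.Properties as ℤₚ
import Data.Integer.Tactic.RingSolver as ℤ-Solver
open import Data.List using ([]; _∷_; _++_; [_]; length)
open import Data.List.Properties using (length-++; ++-assoc; ++-identityʳ; concatMap-++)
open import Data.Nat using (ℕ; zero; suc; _+_; _*_; _∸_; _^_; _≤_; _<_; z≤n; s≤s; z<s; s<s; _≤?_; _<?_)
open import Data.Nat.Properties
open import Data.Nat.Tactic.RingSolver using (solve-∀)
open import Data.Product using (Σ; ∃; ∃₂; _×_; _,_; proj₁; proj₂)
open import Data.Sum using (_⊎_; inj₁; inj₂)
open import Relation.Binary.PropositionalEquality hiding ([_])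
open import Relation.Nullary using (¬_; yes; no)

σ^ : ℕ → Word → Word
σ^ zero    u = u
σ^ (suc k) u = σ^ k (σ* u)

σ*-++ : ∀ u v → σ* (u ++ v) ≡ σ* u ++ σ* v
σ*-++ = concatMap-++ σ

σ^-++ : ∀ k u v → σ^ k (u ++ v) ≡ σ^ k u ++ σ^ k v
σ^-++ zero    u v = refl
σ^-++ (suc k) u v = trans (cong (σ^ k) (σ*-++ u v)) (σ^-++ k (σ* u) (σ* v))

σ^-iter : ∀ k m → σ^ k (iter m) ≡ iter (k + m)
σ^-iter zero    m = refl
σ^-iter (suc k) m = trans (σ^-iter k (suc m)) (cong iter (+-suc k m))

length-σ : ∀ x → length (σ x) ≤ 2
length-σ a0 = ≤-refl
length-σ a1 = ≤-refl
length-σ a3 = n≤1+n 1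
length-σ a4 = ≤-refl

length-σ* : ∀ u → length (σ* u) ≤ 2 * length u
length-σ* []      = z≤n
length-σ* (x ∷ u) = begin
  length (σ x ++ σ* u)         ≡⟨ length-++ (σ x) ⟩
  length (σ x) + length (σ* u) ≤⟨ +-mono-≤ (length-σ x) (length-σ* u) ⟩
  2 + 2 * length u             ≡⟨ *-distribˡ-+ 2 1 (length u) ⟨
  2 * length (x ∷ u)           ∎
  where open ≤-Reasoning

length-σ^ : ∀ k u → length (σ^ k u) ≤ 2 ^ k * length u
length-σ^ zero    u = ≤-reflexive (sym (+-identityʳ (length u)))
length-σ^ (suc k) u = begin
  length (σ^ k (σ* u))     ≤⟨ length-σ^ k (σ* u) ⟩
  2 ^ k * length (σ* u)    ≤⟨ *-monoʳ-≤ (2 ^ k) (length-σ* u) ⟩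
  2 ^ k * (2 * length u)   ≡⟨ reassociate (2 ^ k) (length u) ⟩
  2 ^ suc k * length u     ∎
  where
  open ≤-Reasoning
  reassociate : ∀ e l → e * (2 * l) ≡ 2 * e * l
  reassociate = solve-∀

σ-nonempty : ∀ x → ∃₂ λ y s → σ x ≡ y ∷ s
σ-nonempty a0 = _ , _ , refl
σ-nonempty a1 = _ , _ , refl
σ-nonempty a3 = _ , _ , refl
σ-nonempty a4 = _ , _ , refl

iter-extends : ∀ m → ∃₂ λ x r → iter (suc m) ≡ iter m ++ x ∷ r
iter-extends zero    = a3 , [] , refl
iter-extends (suc m) with iter-extends m
... | x , r , e with σ-nonempty x
...   | y , s , σx≡y∷s = y , s ++ σ* r , (begin
  σ* (iter (suc m))               ≡⟨ cong σ* e ⟩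
  σ* (iter m ++ x ∷ r)            ≡⟨ σ*-++ (iter m) (x ∷ r) ⟩
  iter (suc m) ++ σ x ++ σ* r     ≡⟨ cong (λ v → iter (suc m) ++ v ++ σ* r) σx≡y∷s ⟩
  iter (suc m) ++ y ∷ s ++ σ* r   ∎)
  where open ≡-Reasoning

iter-prefix : ∀ d m → ∃ λ r → iter (d + m) ≡ iter m ++ r
iter-prefix zero    m = [] , sym (++-identityʳ (iter m))
iter-prefix (suc d) m with iter-prefix d m | iter-extends (d + m)
... | r , e | x , s , e′ =
  r ++ x ∷ s , trans e′ (trans (cong (_++ x ∷ s) e) (++-assoc (iter m) r (x ∷ s)))

length-iter : ∀ m → m < length (iter m)
length-iter zero    = z<s
length-iter (suc m) with iter-extends m
... | x , r , e = begin-strict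
  suc m                             ≤⟨ length-iter m ⟩
  length (iter m)                   <⟨ m<m+n (length (iter m)) z<s ⟩
  length (iter m) + length (x ∷ r)  ≡⟨ length-++ (iter m) ⟨
  length (iter m ++ x ∷ r)          ≡⟨ cong length e ⟨
  length (iter (suc m))             ∎
  where open ≤-Reasoning

nth-++ˡ : ∀ u v {i} → i < length u → nth (u ++ v) i ≡ nth u i
nth-++ˡ (x ∷ u) v {zero}  _         = refl
nth-++ˡ (x ∷ u) v {suc i} (s<s i<n) = nth-++ˡ u v i<n

nth-++-length : ∀ u x v → nth (u ++ x ∷ v) (length u) ≡ x
nth-++-length []      x v = refl
nth-++-length (y ∷ u) x v = nth-++-length u x v

nth-iter-stable : ∀ d m {i} → i < length (iter m) → nth (iter (d + m)) i ≡ nth (iter m) i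
nth-iter-stable d m i<n with iter-prefix d m
... | r , e = trans (cong (λ u → nth u _) e) (nth-++ˡ (iter m) r i<n)

w-iter : ∀ m {i} → i < length (iter m) → w i ≡ nth (iter m) i
w-iter m {i} i<n = begin
  nth (iter (suc i)) i      ≡⟨ nth-iter-stable m (suc i) (<-trans (n<1+n i) (length-iter (suc i))) ⟨
  nth (iter (m + suc i)) i  ≡⟨ cong (λ n → nth (iter n) i) (+-comm m (suc i)) ⟩
  nth (iter (suc i + m)) i  ≡⟨ nth-iter-stable (suc i) m i<n ⟩
  nth (iter m) i            ∎
  where open ≡-Reasoning

factor-occurrence : ∀ m α u β → iter m ≡ α ++ u ++ β → factor (length α) (length u) ≡ u
factor-occurrence m α []      β e = refl
factor-occurrence m α (x ∷ u) β e = cong₂ _∷_ head tail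
  where
  α<iter : length α < length (iter m)
  α<iter = subst (λ v → length α < length v) (sym e)
             (subst (length α <_) (sym (length-++ α)) (m<m+n (length α) z<s))
  head : w (length α) ≡ x
  head = trans (w-iter m α<iter)
           (trans (cong (λ v → nth v (length α)) e) (nth-++-length α x (u ++ β)))
  tail : factor (suc (length α)) (length u) ≡ u
  tail = subst (λ i → factor i (length u) ≡ u)
           (trans (length-++ α) (+-comm (length α) 1))
           (factor-occurrence m (α ++ [ x ]) u β (trans e (sym (++-assoc α [ x ] (u ++ β)))))

letter-in-iter3 : ∀ a → ∃₂ λ α β → iter 3 ≡ α ++ [ a ] ++ β
letter-in-iter3 a0 = [] , _ , refl
letter-in-iter3 a1 = a0 ∷ a3 ∷ [] , _ , refl
letter-in-iter3 a3 = a0 ∷ [] , _ , refl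
letter-in-iter3 a4 = a0 ∷ a3 ∷ a1 ∷ [] , _ , refl

σ^-occurs : ∀ k a → ∃ λ i → factor i (length (σ^ k [ a ])) ≡ σ^ k [ a ]
σ^-occurs k a with letter-in-iter3 a
... | α , β , e = length (σ^ k α) , factor-occurrence (k + 3) (σ^ k α) (σ^ k [ a ]) (σ^ k β) (begin
  iter (k + 3)                         ≡⟨ σ^-iter k 3 ⟨
  σ^ k (iter 3)                        ≡⟨ cong (σ^ k) e ⟩
  σ^ k (α ++ [ a ] ++ β)               ≡⟨ σ^-++ k α ([ a ] ++ β) ⟩
  σ^ k α ++ σ^ k ([ a ] ++ β)          ≡⟨ cong (σ^ k α ++_) (σ^-++ k [ a ] β) ⟩
  σ^ k α ++ σ^ k [ a ] ++ σ^ k β       ∎)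
  where open ≡-Reasoning

weight-∷ : ∀ x u → weight (x ∷ u) ≡ val x + weight u
weight-∷ a0 u = refl
weight-∷ a1 u = shift₁ (count a0 u) (count a1 u) (count a3 u) (count a4 u)
  where
  shift₁ : ∀ c₀ c₁ c₃ c₄ → 0 * c₀ + 1 * suc c₁ + 3 * c₃ + 4 * c₄ ≡ 1 + (0 * c₀ + 1 * c₁ + 3 * c₃ + 4 * c₄)
  shift₁ = solve-∀
weight-∷ a3 u = shift₃ (count a0 u) (count a1 u) (count a3 u) (count a4 u)
  where
  shift₃ : ∀ c₀ c₁ c₃ c₄ → 0 * c₀ + 1 * c₁ + 3 * suc c₃ + 4 * c₄ ≡ 3 + (0 * c₀ + 1 * c₁ + 3 * c₃ + 4 * c₄)
  shift₃ = solve-∀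
weight-∷ a4 u = shift₄ (count a0 u) (count a1 u) (count a3 u) (count a4 u)
  where
  shift₄ : ∀ c₀ c₁ c₃ c₄ → 0 * c₀ + 1 * c₁ + 3 * c₃ + 4 * suc c₄ ≡ 4 + (0 * c₀ + 1 * c₁ + 3 * c₃ + 4 * c₄)
  shift₄ = solve-∀

weight-++ : ∀ u v → weight (u ++ v) ≡ weight u + weight v
weight-++ []      v = refl
weight-++ (x ∷ u) v = begin
  weight (x ∷ u ++ v)              ≡⟨ weight-∷ x (u ++ v) ⟩
  val x + weight (u ++ v)          ≡⟨ cong (λ v → val x + v) (weight-++ u v) ⟩
  val x + (weight u + weight v)    ≡⟨ +-assoc (val x) (weight u) (weight v) ⟨
  val x + weight u + weight v      ≡⟨ cong (_+ weight v) (weight-∷ x u) ⟨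
  weight (x ∷ u) + weight v        ∎
  where open ≡-Reasoning

val≤4 : ∀ x → val x ≤ 4
val≤4 a0 = z≤n
val≤4 a1 = s≤s z≤n
val≤4 a3 = n≤1+n 3
val≤4 a4 = ≤-refl

factorWeight : ℕ → ℕ → ℕ
factorWeight i n = weight (factor i n)

factor-+ : ∀ i m n → factor i (m + n) ≡ factor i m ++ factor (i + m) n
factor-+ i zero    n = cong (λ j → factor j n) (sym (+-identityʳ i))
factor-+ i (suc m) n = cong (w i ∷_)
  (trans (factor-+ (suc i) m n) (cong (λ j → factor (suc i) m ++ factor j n) (sym (+-suc i m))))

factorWeight-+ : ∀ i m n → factorWeight i (m + n) ≡ factorWeight i m + factorWeight (i + m) n
factorWeight-+ i m n = trans (cong weight (factor-+ i m n)) (weight-++ (factor i m) (factor (i + m) n))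

factorWeight-slide : ∀ i n → factorWeight i n + val (w (i + n)) ≡ val (w i) + factorWeight (suc i) n
factorWeight-slide i n = begin
  factorWeight i n + val (w (i + n))             ≡⟨ cong (λ v → factorWeight i n + v) (sym (trans (weight-∷ (w (i + n)) []) (+-identityʳ _))) ⟩
  factorWeight i n + factorWeight (i + n) 1      ≡⟨ factorWeight-+ i n 1 ⟨
  factorWeight i (n + 1)                         ≡⟨ cong (factorWeight i) (+-comm n 1) ⟩
  factorWeight i (suc n)                         ≡⟨ weight-∷ (w i) (factor (suc i) n) ⟩
  val (w i) + factorWeight (suc i) n             ∎
  where open ≡-Reasoning

factorWeight-suc-≤ : ∀ n i → factorWeight (suc i) n ≤ factorWeight i n + 4
factorWeight-suc-≤ n i = begin
  factorWeight (suc i) n                  ≤⟨ m≤n+m _ (val (w i)) ⟩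
  val (w i) + factorWeight (suc i) n      ≡⟨ factorWeight-slide i n ⟨
  factorWeight i n + val (w (i + n))      ≤⟨ +-monoʳ-≤ (factorWeight i n) (val≤4 (w (i + n))) ⟩
  factorWeight i n + 4                    ∎
  where open ≤-Reasoning

factorWeight-≤-suc : ∀ n i → factorWeight i n ≤ factorWeight (suc i) n + 4
factorWeight-≤-suc n i = begin
  factorWeight i n                        ≤⟨ m≤m+n _ (val (w (i + n))) ⟩
  factorWeight i n + val (w (i + n))      ≡⟨ factorWeight-slide i n ⟩
  val (w i) + factorWeight (suc i) n      ≤⟨ +-monoˡ-≤ (factorWeight (suc i) n) (val≤4 (w i)) ⟩
  4 + factorWeight (suc i) n              ≡⟨ +-comm 4 _ ⟩
  factorWeight (suc i) n + 4              ∎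
  where open ≤-Reasoning

module _ (s : ℕ) (f : ℕ → ℕ) where

  HitsBand : ℕ → Set
  HitsBand T = ∃ λ t → T ≤ f t × f t < T + s

  hitsBand-up : (∀ t → f (suc t) ≤ f t + s) →
                ∀ a d {T} → f a < T → T ≤ f (d + a) → HitsBand T
  hitsBand-up up a zero    below above = ⊥-elim (<⇒≱ below above)
  hitsBand-up up a (suc d) {T} below above with T ≤? f (d + a)
  ... | yes T≤ = hitsBand-up up a d below T≤
  ... | no  T≰ = suc (d + a) , above , ≤-<-trans (up (d + a)) (+-monoˡ-< s (≰⇒> T≰))

  hitsBand-down : (∀ t → f t ≤ f (suc t) + s) →
                  ∀ a d {T} → T ≤ f a → f (d + a) < T → HitsBand T
  hitsBand-down down a zero    above below = ⊥-elim (<⇒≱ below above)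
  hitsBand-down down a (suc d) {T} above below with T ≤? f (d + a)
  ... | yes T≤ = d + a , T≤ , ≤-<-trans (down (d + a)) (+-monoˡ-< s below)
  ... | no  T≰ = hitsBand-down down a d above (≰⇒> T≰)

  hitsBand : (∀ t → f (suc t) ≤ f t + s) → (∀ t → f t ≤ f (suc t) + s) →
             ∀ a b {T} → f a < T → T ≤ f b → HitsBand T
  hitsBand up down a b below above with ≤-total a b
  ... | inj₁ a≤b = hitsBand-up up a (b ∸ a) below (subst (λ t → _ ≤ f t) (sym (m∸n+n≡m a≤b)) above)
  ... | inj₂ b≤a = hitsBand-down down b (a ∸ b) above (subst (λ t → f t < _) (sym (m∸n+n≡m b≤a)) below)

Gap : ℕ → Set
Gap C = ∃ λ n → ∃₂ λ i j → factorWeight i n + C < factorWeight j n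

gap⇒complexity : ∀ K → Gap (4 * K) → ∃ λ n → AddComplexityAtLeast n K
gap⇒complexity K (n , i , j , gap) = n , position , distinct
  where
  g : ℕ → ℕ
  g t = factorWeight t n
  -- the bands [T x, T x + 4) are disjoint, lie between g i and g j, and each is hit
  T : Fin K → ℕ
  T x = suc (g i + 4 * toℕ x)
  hit : ∀ x → HitsBand 4 g (T x)
  hit x = hitsBand 4 g (factorWeight-suc-≤ n) (factorWeight-≤-suc n) i j
            (s≤s (m≤m+n (g i) _))
            (≤-trans (s≤s (+-monoʳ-≤ (g i) (*-monoʳ-≤ 4 (<⇒≤ (toℕ<n x))))) gap)
  position : Fin K → ℕ
  position x = proj₁ (hit x)
  increasing : ∀ x y → toℕ x < toℕ y → g (position x) < g (position y)
  increasing x y x<y = begin-strict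
    g (position x)               <⟨ proj₂ (proj₂ (hit x)) ⟩
    T x + 4                      ≡⟨ next-band (g i) (toℕ x) ⟩
    suc (g i + 4 * suc (toℕ x))  ≤⟨ s≤s (+-monoʳ-≤ (g i) (*-monoʳ-≤ 4 x<y)) ⟩
    T y                          ≤⟨ proj₁ (proj₂ (hit y)) ⟩
    g (position y)               ∎
    where
    open ≤-Reasoning
    next-band : ∀ c t → suc (c + 4 * t) + 4 ≡ suc (c + 4 * suc t)
    next-band = solve-∀
  distinct : ∀ x y → ¬ x ≡ y → ¬ AddEquiv (factor (position x) n) (factor (position y) n)
  distinct x y x≢y (_ , same) = x≢y (toℕ-injective (≤-antisym
    (≮⇒≥ λ y<x → <-irrefl (sym same) (increasing y x y<x))
    (≮⇒≥ λ x<y → <-irrefl same (increasing x y x<y))))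

factorWeight-blocks : ∀ n t → factorWeight 0 (suc t * n) ≡ factorWeight 0 (t * n) + factorWeight (t * n) n
factorWeight-blocks n t = trans (cong (factorWeight 0) (+-comm n (t * n))) (factorWeight-+ 0 (t * n) n)

gap⊎prefixWeight≤ : ∀ C n i t → Gap C ⊎ factorWeight 0 (t * n) ≤ t * (factorWeight i n + C)
gap⊎prefixWeight≤ C n i zero = inj₂ z≤n
gap⊎prefixWeight≤ C n i (suc t) with gap⊎prefixWeight≤ C n i t | factorWeight (t * n) n ≤? factorWeight i n + C
... | inj₁ gap | _       = inj₁ gap
... | inj₂ _   | no  big = inj₁ (n , i , t * n , ≰⇒> big)
... | inj₂ ih  | yes small = inj₂ (begin
  factorWeight 0 (suc t * n)                          ≡⟨ factorWeight-blocks n t ⟩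
  factorWeight 0 (t * n) + factorWeight (t * n) n     ≤⟨ +-mono-≤ ih small ⟩
  t * (factorWeight i n + C) + (factorWeight i n + C) ≡⟨ +-comm _ (factorWeight i n + C) ⟩
  suc t * (factorWeight i n + C)                      ∎)
  where open ≤-Reasoning

gap⊎prefixWeight≥ : ∀ C n j t → Gap C ⊎ t * factorWeight j n ≤ factorWeight 0 (t * n) + t * C
gap⊎prefixWeight≥ C n j zero = inj₂ z≤n
gap⊎prefixWeight≥ C n j (suc t) with gap⊎prefixWeight≥ C n j t | factorWeight (t * n) n + C <? factorWeight j n
... | inj₁ gap | _         = inj₁ gap
... | inj₂ _   | yes small = inj₁ (n , t * n , j , small)
... | inj₂ ih  | no  ≮big  = inj₂ (begin
  factorWeight j n + t * factorWeight j n                        ≤⟨ +-mono-≤ (≮⇒≥ ≮big) ih ⟩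
  factorWeight (t * n) n + C + (factorWeight 0 (t * n) + t * C)  ≡⟨ regroup (factorWeight 0 (t * n)) (factorWeight (t * n) n) C (t * C) ⟩
  factorWeight 0 (t * n) + factorWeight (t * n) n + (C + t * C)  ≡⟨ cong (_+ (C + t * C)) (factorWeight-blocks n t) ⟨
  factorWeight 0 (suc t * n) + suc t * C                         ∎)
  where
  open ≤-Reasoning
  regroup : ∀ a b c d → b + c + (a + d) ≡ a + b + (c + d)
  regroup = solve-∀

minor⇒gap : ∀ C i n j m → (n + m) * C + m * factorWeight i n < n * factorWeight j m → Gap C
minor⇒gap C i n j m big with gap⊎prefixWeight≤ C n i m | gap⊎prefixWeight≥ C m j n
... | inj₁ gap | _        = gap
... | inj₂ _   | inj₁ gap = gap
... | inj₂ upper | inj₂ lower = ⊥-elim (<⇒≱ big (begin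
  n * factorWeight j m                   ≤⟨ lower ⟩
  factorWeight 0 (n * m) + n * C         ≡⟨ cong (λ l → factorWeight 0 l + n * C) (*-comm n m) ⟩
  factorWeight 0 (m * n) + n * C         ≤⟨ +-monoˡ-≤ (n * C) upper ⟩
  m * (factorWeight i n + C) + n * C     ≡⟨ regroup n m (factorWeight i n) C ⟩
  (n + m) * C + m * factorWeight i n     ∎))
  where
  open ≤-Reasoning
  regroup : ∀ n m u C → m * (u + C) + n * C ≡ (n + m) * C + m * u
  regroup = solve-∀

profile : (Word → ℕ) → ℕ → Letter → ℕ
profile f k a = f (σ^ k [ a ])

lengths weights : ℕ → Letter → ℕ
lengths = profile length
weights = profile weight

lengths≤ : ∀ k a → lengths k a ≤ 2 ^ k
lengths≤ k a = ≤-trans (length-σ^ k [ a ]) (≤-reflexive (*-identityʳ (2 ^ k)))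

σ^-occurrence-weight : ∀ k a → ∃ λ i → factorWeight i (lengths k a) ≡ weights k a
σ^-occurrence-weight k a with σ^-occurs k a
... | i , e = i , cong weight e

-- P a sums p over the letters of σ a, i.e. P = p M for the incidence matrix M of σ.
IsσImage : (p P : Letter → ℕ) → Set
IsσImage p P = P a0 ≡ p a0 + p a3 × P a1 ≡ p a4 + p a3 × P a3 ≡ p a1 × P a4 ≡ p a0 + p a1

module _ (f : Word → ℕ) (f-++ : ∀ u v → f (u ++ v) ≡ f u + f v) where

  profile-σ^-pair : ∀ k x y → f (σ^ k (x ∷ y ∷ [])) ≡ profile f k x + profile f k y
  profile-σ^-pair k x y = trans (cong f (σ^-++ k [ x ] [ y ])) (f-++ _ _)

  profile-σImage : ∀ k → IsσImage (profile f k) (profile f (suc k))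
  profile-σImage k = profile-σ^-pair k a0 a3 , profile-σ^-pair k a4 a3 , refl , profile-σ^-pair k a0 a1

minor : (p q : Letter → ℕ) → Letter → Letter → ℤ
minor p q a b = + p a ℤ.* + q b ℤ.- + p b ℤ.* + q a

minor≡+⇒ : ∀ p q a b {d} → minor p q a b ≡ + d → p a * q b ≡ p b * q a + d
minor≡+⇒ p q a b {d} e = ℤₚ.+-injective (begin
  + (p a * q b)                               ≡⟨ ℤₚ.pos-* (p a) (q b) ⟩
  + p a ℤ.* + q b                             ≡⟨ minus-plus (+ p a ℤ.* + q b) (+ p b ℤ.* + q a) ⟩
  minor p q a b ℤ.+ + p b ℤ.* + q a           ≡⟨ cong₂ ℤ._+_ e (sym (ℤₚ.pos-* (p b) (q a))) ⟩
  + d ℤ.+ + (p b * q a)                       ≡⟨ ℤₚ.+-comm (+ d) (+ (p b * q a)) ⟩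
  + (p b * q a + d)                           ∎)
  where
  open ≡-Reasoning
  minus-plus : ∀ x y → x ≡ x ℤ.- y ℤ.+ y
  minus-plus = ℤ-Solver.solve-∀

minor-exceeds : ∀ p q a b {d D} → minor p q a b ≡ + d → D < d → D + p b * q a < p a * q b
minor-exceeds p q a b {d} {D} e D<d = begin-strict
  D + p b * q a      ≡⟨ +-comm D _ ⟩
  p b * q a + D      <⟨ +-monoʳ-< (p b * q a) D<d ⟩
  p b * q a + d      ≡⟨ minor≡+⇒ p q a b e ⟨
  p a * q b          ∎
  where open ≤-Reasoning

record PositiveMinors (p q : Letter → ℕ) : Set where
  field
    d01 d30 d40 d31 d41 d34 : ℕ
    minor01 : minor p q a0 a1 ≡ + d01
    minor30 : minor p q a3 a0 ≡ + d30
    minor40 : minor p q a4 a0 ≡ + d40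
    minor31 : minor p q a3 a1 ≡ + d31
    minor41 : minor p q a4 a1 ≡ + d41
    minor34 : minor p q a3 a4 ≡ + d34
    -- keeps d01 = d30 + d40 - d34 of the next step nonnegative
    d34≤d30+d40 : d34 ≤ d30 + d40

  potential : ℕ
  potential = d30 + d40 + 4 * d31 + 3 * d41

open PositiveMinors using (potential)

-- The roles of p and q swap: it is the minors of (σ-image of q, σ-image of p) that are
-- nonnegative combinations of the minors of (p, q).
positiveMinors-step : ∀ {p q P Q} (I : PositiveMinors p q) → IsσImage q P → IsσImage p Q →
                      Σ (PositiveMinors P Q) λ I′ → 9 * potential I ≤ 4 * potential I′
positiveMinors-step {p} {q} {P} {Q} I (P0 , P1 , P3 , P4) (Q0 , Q1 , Q3 , Q4) = I′ , growth
  where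
  open PositiveMinors I hiding (potential)
  p₀ = + p a0 ; p₁ = + p a1 ; p₃ = + p a3 ; p₄ = + p a4
  q₀ = + q a0 ; q₁ = + q a1 ; q₃ = + q a3 ; q₄ = + q a4

  minor01′ : minor P Q a0 a1 ≡ + (d30 + d40 ∸ d34)
  minor01′ rewrite P0 | P1 | Q0 | Q1 = begin
    (q₀ ℤ.+ q₃) ℤ.* (p₄ ℤ.+ p₃) ℤ.- (q₄ ℤ.+ q₃) ℤ.* (p₀ ℤ.+ p₃)  ≡⟨ expand p₀ p₃ p₄ q₀ q₃ q₄ ⟩
    minor p q a3 a0 ℤ.+ minor p q a4 a0 ℤ.- minor p q a3 a4       ≡⟨ cong₂ ℤ._-_ (cong₂ ℤ._+_ minor30 minor40) minor34 ⟩
    + (d30 + d40) ℤ.- + d34                                         ≡⟨ ℤₚ.m-n≡m⊖n (d30 + d40) d34 ⟩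
    (d30 + d40) ℤ.⊖ d34                                            ≡⟨ ℤₚ.⊖-≥ d34≤d30+d40 ⟩
    + (d30 + d40 ∸ d34)                                             ∎
    where
    open ≡-Reasoning
    expand : ∀ p₀ p₃ p₄ q₀ q₃ q₄ → (q₀ ℤ.+ q₃) ℤ.* (p₄ ℤ.+ p₃) ℤ.- (q₄ ℤ.+ q₃) ℤ.* (p₀ ℤ.+ p₃)
             ≡ (p₃ ℤ.* q₀ ℤ.- p₀ ℤ.* q₃) ℤ.+ (p₄ ℤ.* q₀ ℤ.- p₀ ℤ.* q₄) ℤ.- (p₃ ℤ.* q₄ ℤ.- p₄ ℤ.* q₃)
    expand = ℤ-Solver.solve-∀

  minor30′ : minor P Q a3 a0 ≡ + (d01 + d31)
  minor30′ rewrite P3 | P0 | Q0 | Q3 = trans (expand p₀ p₁ p₃ q₀ q₁ q₃) (cong₂ ℤ._+_ minor01 minor31)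
    where
    expand : ∀ p₀ p₁ p₃ q₀ q₁ q₃ → q₁ ℤ.* (p₀ ℤ.+ p₃) ℤ.- (q₀ ℤ.+ q₃) ℤ.* p₁
             ≡ (p₀ ℤ.* q₁ ℤ.- p₁ ℤ.* q₀) ℤ.+ (p₃ ℤ.* q₁ ℤ.- p₁ ℤ.* q₃)
    expand = ℤ-Solver.solve-∀

  minor40′ : minor P Q a4 a0 ≡ + (d01 + d30 + d31)
  minor40′ rewrite P4 | P0 | Q0 | Q4 =
    trans (expand p₀ p₁ p₃ q₀ q₁ q₃) (cong₂ ℤ._+_ (cong₂ ℤ._+_ minor01 minor30) minor31)
    where
    expand : ∀ p₀ p₁ p₃ q₀ q₁ q₃ → (q₀ ℤ.+ q₁) ℤ.* (p₀ ℤ.+ p₃) ℤ.- (q₀ ℤ.+ q₃) ℤ.* (p₀ ℤ.+ p₁)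
             ≡ (p₀ ℤ.* q₁ ℤ.- p₁ ℤ.* q₀) ℤ.+ (p₃ ℤ.* q₀ ℤ.- p₀ ℤ.* q₃) ℤ.+ (p₃ ℤ.* q₁ ℤ.- p₁ ℤ.* q₃)
    expand = ℤ-Solver.solve-∀

  minor31′ : minor P Q a3 a1 ≡ + (d31 + d41)
  minor31′ rewrite P3 | P1 | Q1 | Q3 = trans (expand p₁ p₃ p₄ q₁ q₃ q₄) (cong₂ ℤ._+_ minor31 minor41)
    where
    expand : ∀ p₁ p₃ p₄ q₁ q₃ q₄ → q₁ ℤ.* (p₄ ℤ.+ p₃) ℤ.- (q₄ ℤ.+ q₃) ℤ.* p₁
             ≡ (p₃ ℤ.* q₁ ℤ.- p₁ ℤ.* q₃) ℤ.+ (p₄ ℤ.* q₁ ℤ.- p₁ ℤ.* q₄)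
    expand = ℤ-Solver.solve-∀

  minor41′ : minor P Q a4 a1 ≡ + (d30 + d40 + d31 + d41)
  minor41′ rewrite P4 | P1 | Q1 | Q4 =
    trans (expand p₀ p₁ p₃ p₄ q₀ q₁ q₃ q₄)
          (cong₂ ℤ._+_ (cong₂ ℤ._+_ (cong₂ ℤ._+_ minor30 minor40) minor31) minor41)
    where
    expand : ∀ p₀ p₁ p₃ p₄ q₀ q₁ q₃ q₄ → (q₀ ℤ.+ q₁) ℤ.* (p₄ ℤ.+ p₃) ℤ.- (q₄ ℤ.+ q₃) ℤ.* (p₀ ℤ.+ p₁)
             ≡ (p₃ ℤ.* q₀ ℤ.- p₀ ℤ.* q₃) ℤ.+ (p₄ ℤ.* q₀ ℤ.- p₀ ℤ.* q₄)
               ℤ.+ (p₃ ℤ.* q₁ ℤ.- p₁ ℤ.* q₃) ℤ.+ (p₄ ℤ.* q₁ ℤ.- p₁ ℤ.* q₄)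
    expand = ℤ-Solver.solve-∀

  minor34′ : minor P Q a3 a4 ≡ + d01
  minor34′ rewrite P3 | P4 | Q4 | Q3 = trans (expand p₀ p₁ q₀ q₁) minor01
    where
    expand : ∀ p₀ p₁ q₀ q₁ → q₁ ℤ.* (p₀ ℤ.+ p₁) ℤ.- (q₀ ℤ.+ q₁) ℤ.* p₁ ≡ p₀ ℤ.* q₁ ℤ.- p₁ ℤ.* q₀
    expand = ℤ-Solver.solve-∀

  I′ : PositiveMinors P Q
  I′ = record
    { minor01 = minor01′ ; minor30 = minor30′ ; minor40 = minor40′
    ; minor31 = minor31′ ; minor41 = minor41′ ; minor34 = minor34′
    ; d34≤d30+d40 = ≤-trans (m≤m+n d01 d31) (m≤m+n (d01 + d31) _)
    }

  growth : 9 * potential I ≤ 4 * potential I′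
  growth = begin
    9 * potential I                                  ≤⟨ m≤m+n _ (8 * d01 + 7 * d30 + 3 * d40 + d41) ⟩
    9 * potential I + (8 * d01 + 7 * d30 + 3 * d40 + d41) ≡⟨ regroup d01 d30 d40 d31 d41 ⟩
    4 * potential I′                                 ∎
    where
    open ≤-Reasoning
    regroup : ∀ d01 d30 d40 d31 d41 →
              9 * (d30 + d40 + 4 * d31 + 3 * d41) + (8 * d01 + 7 * d30 + 3 * d40 + d41)
              ≡ 4 * ((d01 + d31) + (d01 + d30 + d31) + 4 * (d31 + d41) + 3 * (d30 + d40 + d31 + d41))
    regroup = solve-∀

PotentialAtLeast : (p q : Letter → ℕ) → ℕ → Set
PotentialAtLeast p q g = Σ (PositiveMinors p q) λ I → g ≤ potential I

potentialAtLeast-step : ∀ {p q P Q g g′} → 4 * g′ ≤ 9 * g → PotentialAtLeast p q g →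
                        IsσImage q P → IsσImage p Q → PotentialAtLeast P Q g′
potentialAtLeast-step {g = g} {g′} 4g′≤9g (I , g≤) qP pQ with positiveMinors-step I qP pQ
... | I′ , growth = I′ , *-cancelˡ-≤ 4 (begin
  4 * g′             ≤⟨ 4g′≤9g ⟩
  9 * g              ≤⟨ *-monoʳ-≤ 9 g≤ ⟩
  9 * potential I    ≤⟨ growth ⟩
  4 * potential I′   ∎)
  where open ≤-Reasoning

data Oriented (k g : ℕ) : Set where
  lengths-first : PotentialAtLeast (lengths k) (weights k) g → Oriented k g
  weights-first : PotentialAtLeast (weights k) (lengths k) g → Oriented k g

lengths-σImage : ∀ k → IsσImage (lengths k) (lengths (suc k))
lengths-σImage = profile-σImage length (λ u _ → length-++ u)

weights-σImage : ∀ k → IsσImage (weights k) (weights (suc k))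
weights-σImage = profile-σImage weight weight-++

oriented-suc : ∀ {k g g′} → 4 * g′ ≤ 9 * g → Oriented k g → Oriented (suc k) g′
oriented-suc {k} le (lengths-first I) =
  weights-first (potentialAtLeast-step le I (weights-σImage k) (lengths-σImage k))
oriented-suc {k} le (weights-first I) =
  lengths-first (potentialAtLeast-step le I (lengths-σImage k) (weights-σImage k))

-- 2ʲ (8 + j) grows by a factor below 9/4, starts below the potential 161 of σ², and
-- eventually beats any multiple of 2ʲ.
oriented : ∀ j → Oriented (2 + j) (2 ^ j * (8 + j))
oriented zero    = weights-first (minors₂ , m≤m+n 8 153)
  where
  minors₂ : PositiveMinors (weights 2) (lengths 2)
  minors₂ = record
    { d01 = 6 ; d30 = 13 ; d40 = 14 ; d31 = 17 ; d41 = 22 ; d34 = 8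
    ; minor01 = refl ; minor30 = refl ; minor40 = refl
    ; minor31 = refl ; minor41 = refl ; minor34 = refl
    ; d34≤d30+d40 = m≤m+n 8 19
    }
oriented (suc j) = oriented-suc ratio (oriented j)
  where
  e = 2 ^ j
  ratio : 4 * (2 ^ suc j * (8 + suc j)) ≤ 9 * (e * (8 + j))
  ratio = begin
    4 * (2 * e * (9 + j))   ≡⟨ lhs e j ⟩
    e * (72 + 8 * j)        ≤⟨ *-monoʳ-≤ e (+-monoʳ-≤ 72 (*-monoˡ-≤ j (n≤1+n 8))) ⟩
    e * (72 + 9 * j)        ≡⟨ rhs e j ⟩
    9 * (e * (8 + j))       ∎
    where
    open ≤-Reasoning
    lhs : ∀ e j → 4 * (2 * e * (9 + j)) ≡ e * (72 + 8 * j)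
    lhs = solve-∀
    rhs : ∀ e j → e * (72 + 9 * j) ≡ 9 * (e * (8 + j))
    rhs = solve-∀

record MinorExceeds (p q : Letter → ℕ) (D : ℕ) : Set where
  constructor exceedsAt
  field
    a b     : Letter
    exceeds : D + p b * q a < p a * q b

minorExceeds-swap : ∀ {p q D} → MinorExceeds p q D → MinorExceeds q p D
minorExceeds-swap {p} {q} {D} (exceedsAt a b exceeds) =
  exceedsAt b a (subst₂ (λ x y → D + x < y) (*-comm (p b) (q a)) (*-comm (p a) (q b)) exceeds)

module _ {p q : Letter → ℕ} (I : PositiveMinors p q) where
  open PositiveMinors I hiding (potential)

  positiveMinors⇒minorExceeds : ∀ {D} → 9 * D < potential I → MinorExceeds p q D
  positiveMinors⇒minorExceeds {D} big with D <? d30 | D <? d40 | D <? d31 | D <? d41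
  ... | yes D<d | _     | _     | _       = exceedsAt a3 a0 (minor-exceeds p q a3 a0 minor30 D<d)
  ... | no _    | yes D<d | _   | _       = exceedsAt a4 a0 (minor-exceeds p q a4 a0 minor40 D<d)
  ... | no _    | no _  | yes D<d | _     = exceedsAt a3 a1 (minor-exceeds p q a3 a1 minor31 D<d)
  ... | no _    | no _  | no _  | yes D<d = exceedsAt a4 a1 (minor-exceeds p q a4 a1 minor41 D<d)
  ... | no D≮d₃₀ | no D≮d₄₀ | no D≮d₃₁ | no D≮d₄₁ = ⊥-elim (<⇒≱ big (begin
    d30 + d40 + 4 * d31 + 3 * d41   ≤⟨ +-mono-≤ (+-mono-≤ (+-mono-≤ (≮⇒≥ D≮d₃₀) (≮⇒≥ D≮d₄₀))
                                                (*-monoʳ-≤ 4 (≮⇒≥ D≮d₃₁))) (*-monoʳ-≤ 3 (≮⇒≥ D≮d₄₁)) ⟩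
    D + D + 4 * D + 3 * D           ≡⟨ nine D ⟩
    9 * D                           ∎))
    where
    open ≤-Reasoning
    nine : ∀ D → D + D + 4 * D + 3 * D ≡ 9 * D
    nine = solve-∀

oriented⇒minorExceeds : ∀ {k g D} → Oriented k g → 9 * D < g → MinorExceeds (lengths k) (weights k) D
oriented⇒minorExceeds (lengths-first (I , g≤)) big = positiveMinors⇒minorExceeds I (<-≤-trans big g≤)
oriented⇒minorExceeds (weights-first (I , g≤)) big = minorExceeds-swap (positiveMinors⇒minorExceeds I (<-≤-trans big g≤))

minorExceeds⇒gap : ∀ k C → MinorExceeds (lengths k) (weights k) ((2 ^ k + 2 ^ k) * C) → Gap C
minorExceeds⇒gap k C (exceedsAt a b exceeds) with σ^-occurrence-weight k a | σ^-occurrence-weight k b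
... | i , eᵢ | j , eⱼ = minor⇒gap C i (lengths k a) j (lengths k b) (begin-strict
  (lengths k a + lengths k b) * C + lengths k b * factorWeight i (lengths k a)
      ≡⟨ cong (λ v → (lengths k a + lengths k b) * C + lengths k b * v) eᵢ ⟩
  (lengths k a + lengths k b) * C + lengths k b * weights k a
      ≤⟨ +-monoˡ-≤ _ (*-monoˡ-≤ C (+-mono-≤ (lengths≤ k a) (lengths≤ k b))) ⟩
  (2 ^ k + 2 ^ k) * C + lengths k b * weights k a
      <⟨ exceeds ⟩
  lengths k a * weights k b
      ≡⟨ cong (lengths k a *_) eⱼ ⟨
  lengths k a * factorWeight j (lengths k b) ∎)
  where open ≤-Reasoning

lengths-outgrown : ∀ C → let j = 72 * C in 9 * ((2 ^ (2 + j) + 2 ^ (2 + j)) * C) < 2 ^ j * (8 + j)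
lengths-outgrown C = begin-strict
  9 * ((2 ^ (2 + j) + 2 ^ (2 + j)) * C)  ≡⟨ regroup (2 ^ j) C ⟩
  2 ^ j * (72 * C)                       <⟨ *-monoʳ-< (2 ^ j) {{m^n≢0 2 j}} (m<n+m (72 * C) {8} z<s) ⟩
  2 ^ j * (8 + 72 * C)                   ∎
  where
  open ≤-Reasoning
  j = 72 * C
  regroup : ∀ e C → 9 * ((2 * (2 * e) + 2 * (2 * e)) * C) ≡ e * (72 * C)
  regroup = solve-∀

proposition4p10 : AddComplexityUnbounded
proposition4p10 K = gap⇒complexity K (gap (4 * K))
  where
  gap : ∀ C → Gap C
  gap C = minorExceeds⇒gap k C
            (oriented⇒minorExceeds (oriented (72 * C)) (lengths-outgrown C))
    where k = 2 + 72 * C
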